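{- Let $G$ be any connected simple graph on $[N]$ and $e=uv$ any edge of $G$. If $c\in\mathfrak{D}(G)$, then $\alpha^{\triangle}(c):=(c,1)\in\mathbb{Z}^{N+1}$ belongs to $\mathfrak{D}(G\triangle e)$. Moreover, $\alpha^{\triangle}:\mathfrak{D}(G)\to\mathfrak{D}(G\triangle e)$ is injective.
   Context: Let $\mathcal{N}_G(i)$ denote the set of neighbors of $i$ in a graph $G$ on $[N]$. A sequence $(a_1,\dots,a_N)\in\mathbb{Z}_{\ge0}^N$ is $D(G)$-draconian if $\sum_i a_i=N-1$ and for every nonempty $S\subseteq[N]$, $\sum_{i\in S}a_i<\left|S\cup\bigcup_{i\in S}\mathcal{N}_G(i)\right|$; $\mathfrak{D}(G)$ is the set of such sequences. $G\triangle e$ is the graph on $[N+1]$ with edge set $E(G)\cup\{u(N+1),v(N+1)\}$. -}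

module Defs where

open import Data.Nat using (ℕ; zero; suc; _+_; _<_)
open import Data.Bool using (Bool; true; false; _∨_; _∧_; if_then_else_)
open import Data.Fin using (Fin; zero; suc; fromℕ; inject₁; _≟_)
open import Data.Fin.Subset using (Subset; _∈_; ∣_∣; Nonempty; inside; outside)
open import Data.Vec.Base using (Vec; tabulate; lookup; sum; zipWith)
open import Data.Product using (_×_; Σ; ∃)
open import Relation.Nullary using (¬_; does)
open import Relation.Binary.PropositionalEquality using (_≡_; refl)
open import Data.Maybe using (Maybe; just; nothing)
import Data.Maybe

record Graph (N : ℕ) : Set where
  field
    adj   : Fin N → Fin N → Bool
    sym   : ∀ i j → adj i j ≡ adj j i
    irrefl : ∀ i → adj i i ≡ false
open Graph public

data Walk {N : ℕ} (G : Graph N) : Fin N → Fin N → Set where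
  here : ∀ {i} → Walk G i i
  step : ∀ {i j k} → adj G i j ≡ true → Walk G j k → Walk G i k

Connected : {N : ℕ} → Graph N → Set
Connected G = ∀ i j → Walk G i j

anyFin : {N : ℕ} → (Fin N → Bool) → Bool
anyFin {zero} f = false
anyFin {suc N} f = f zero ∨ anyFin (λ k → f (suc k))

isInside : Data.Fin.Subset.Side → Bool
isInside inside = true
isInside outside = false

closedNbhd : {N : ℕ} → Graph N → Subset N → Subset N
closedNbhd G S = tabulate λ j →
  if isInside (lookup S j) ∨ anyFin (λ k → isInside (lookup S k) ∧ adj G k j)
  then inside else outside

sumOver : {N : ℕ} → (Fin N → ℕ) → Subset N → ℕ
sumOver a S = sum (tabulate λ i → if isInside (lookup S i) then a i else 0)

sumAll : {N : ℕ} → (Fin N → ℕ) → ℕ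
sumAll a = sum (tabulate a)

-- a ∈ 𝔇(G): ∑ a_i = N - 1 and for every nonempty S, ∑_{i∈S} a_i < |S ∪ N_G(S)|
-- (stated as ∑ a_i + 1 = N to avoid truncated subtraction; N ≥ 1 in context)
Draconian : {N : ℕ} → Graph N → (Fin N → ℕ) → Set
Draconian {N} G a =
  (sumAll a + 1 ≡ N) ×
  (∀ (S : Subset N) → Nonempty S → sumOver a S < ∣ closedNbhd G S ∣)

-- G △ e on [N+1]: old vertices are inject₁ i, the new vertex N+1 is fromℕ N,
-- adjacent exactly to u and v.
isEq : {N : ℕ} → Fin N → Fin N → Bool
isEq i j = does (i ≟ j)

decode : {N : ℕ} → Fin (suc N) → Maybe (Fin N)
decode {zero} zero = nothing
decode {suc N} zero = just zero
decode {suc N} (suc x) = Data.Maybe.map suc (decode x)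

triAdjM : {N : ℕ} → Graph N → Fin N → Fin N → Maybe (Fin N) → Maybe (Fin N) → Bool
triAdjM G u v (just i) (just j) = adj G i j
triAdjM G u v (just i) nothing  = isEq i u ∨ isEq i v
triAdjM G u v nothing  (just j) = isEq j u ∨ isEq j v
triAdjM G u v nothing  nothing  = false

triangle : {N : ℕ} → (G : Graph N) → (u v : Fin N) → Graph (suc N)
triangle G u v = record
  { adj = λ i j → triAdjM G u v (decode i) (decode j)
  ; sym = λ i j → symM (decode i) (decode j)
  ; irrefl = λ i → irrM (decode i)
  }
  where
  symM : ∀ x y → triAdjM G u v x y ≡ triAdjM G u v y x
  symM (just i) (just j) = Graph.sym G i j
  symM (just i) nothing = refl
  symM nothing (just j) = refl
  symM nothing nothing = refl
  irrM : ∀ x → triAdjM G u v x x ≡ false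
  irrM (just i) = Graph.irrefl G i
  irrM nothing = refl

extendOne : {N : ℕ} → (Fin N → ℕ) → Fin (suc N) → ℕ
extendOne c i with decode i
... | just j  = c j
... | nothing = 1

module Submission where

-- For S ⊆ [N+1] write T for its trace on the old vertices [N]. The closed
-- neighbourhood of T in G sits inside the trace of that of S in G △ e, and the new
-- vertex has weight 1 and lies in N[S] whenever it lies in S; so the Hall-type
-- bound for c at T gives the bound for (c,1) at S. If T is empty, S is the new
-- vertex alone, of weight 1, while N[S] contains it and u. Injectivity is read
-- off the old coordinates.

open import Defs hiding (sym)
open import Data.Nat using (ℕ; zero; suc; _+_; _≤_; _<_; z≤n)
open import Data.Nat.Properties
  using (+-identityʳ; +-assoc; +-comm; +-mono-<-≤; ≤-refl; ≤-<-trans; <-≤-trans; module ≤-Reasoning)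
open import Data.Fin using (Fin; zero; suc; inject₁; fromℕ; _≟_)
open import Data.Fin.Subset using (Subset; inside; outside; _∈_; _⊆_; ⊥; Nonempty; Empty; ∣_∣)
open import Data.Fin.Subset.Properties using (nonempty?; Empty-unique; p⊆q⇒∣p∣≤∣q∣; x∈p⇒∣p-x∣<∣p∣)
open import Data.Bool using (Bool; true; false; _∨_; _∧_; if_then_else_)
open import Data.Bool.Properties using (∨-zeroʳ)
open import Data.Vec.Base using ([]; _∷_; tabulate; lookup; sum)
open import Data.Vec.Properties using (lookup∘tabulate; tabulate-cong; []=⇒lookup; lookup⇒[]=)
open import Data.Product using (_×_; _,_; ∃; proj₁; proj₂)
open import Data.Sum using (_⊎_; inj₁; inj₂)
open import Data.Maybe using (just; nothing)
open import Function using (_∘_)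
open import Relation.Nullary using (yes; no; contradiction)
open import Relation.Nullary.Decidable using (dec-true)
open import Relation.Binary.PropositionalEquality
  using (_≡_; refl; sym; trans; cong; cong₂; subst; module ≡-Reasoning)

private
  variable
    n : ℕ

inject₁-or-fromℕ : (x : Fin (suc n)) → (∃ λ i → inject₁ i ≡ x) ⊎ fromℕ n ≡ x
inject₁-or-fromℕ {zero} zero = inj₂ refl
inject₁-or-fromℕ {suc n} zero = inj₁ (zero , refl)
inject₁-or-fromℕ {suc n} (suc x) with inject₁-or-fromℕ x
... | inj₁ (i , refl) = inj₁ (suc i , refl)
... | inj₂ refl = inj₂ refl

sum-tabulate-inject₁ : (f : Fin (suc n) → ℕ) →
  sum (tabulate f) ≡ sum (tabulate (f ∘ inject₁)) + f (fromℕ n)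
sum-tabulate-inject₁ {zero} f = +-identityʳ (f zero)
sum-tabulate-inject₁ {suc n} f =
  trans (cong (f zero +_) (sum-tabulate-inject₁ (f ∘ suc))) (sym (+-assoc (f zero) _ _))

indicator : Bool → ℕ
indicator b = if isInside b then 1 else 0

indicator-mono : ∀ {p q : Subset n} {x} → p ⊆ q → indicator (lookup p x) ≤ indicator (lookup q x)
indicator-mono {p = p} {q} {x} p⊆q with lookup p x in px
... | false = z≤n
... | true rewrite []=⇒lookup (p⊆q (lookup⇒[]= x p px)) = ≤-refl

∈⇒0<∣∣ : ∀ {p : Subset n} {x} → x ∈ p → 0 < ∣ p ∣
∈⇒0<∣∣ x∈p = ≤-<-trans z≤n (x∈p⇒∣p-x∣<∣p∣ x∈p)

restrict : Subset (suc n) → Subset n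
restrict S = tabulate (lookup S ∘ inject₁)

∈-restrict⁺ : ∀ {S : Subset (suc n)} {i} → inject₁ i ∈ S → i ∈ restrict S
∈-restrict⁺ {S = S} {i} i∈S =
  lookup⇒[]= i (restrict S) (trans (lookup∘tabulate (lookup S ∘ inject₁) i) ([]=⇒lookup i∈S))

∈-restrict⁻ : ∀ {S : Subset (suc n)} {i} → i ∈ restrict S → inject₁ i ∈ S
∈-restrict⁻ {S = S} {i} i∈T =
  lookup⇒[]= (inject₁ i) S (trans (sym (lookup∘tabulate (lookup S ∘ inject₁) i)) ([]=⇒lookup i∈T))

Empty-restrict⇒fromℕ∈ : ∀ {S : Subset (suc n)} → Nonempty S → Empty (restrict S) → fromℕ n ∈ S
Empty-restrict⇒fromℕ∈ (x , x∈S) empty with inject₁-or-fromℕ x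
... | inj₁ (i , refl) = contradiction (i , ∈-restrict⁺ x∈S) empty
... | inj₂ refl = x∈S

∣∣-restrict : (X : Subset (suc n)) → ∣ X ∣ ≡ ∣ restrict X ∣ + indicator (lookup X (fromℕ n))
∣∣-restrict {zero} (inside ∷ []) = refl
∣∣-restrict {zero} (outside ∷ []) = refl
∣∣-restrict {suc n} (inside ∷ X) = cong suc (∣∣-restrict X)
∣∣-restrict {suc n} (outside ∷ X) = ∣∣-restrict X

sumOver-cong : ∀ {a b : Fin n → ℕ} → (∀ i → a i ≡ b i) → ∀ S → sumOver a S ≡ sumOver b S
sumOver-cong a≗b S = cong sum (tabulate-cong λ i → cong (if isInside (lookup S i) then_else 0) (a≗b i))

sumOver-⊥ : (a : Fin n → ℕ) → sumOver a ⊥ ≡ 0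
sumOver-⊥ {zero} a = refl
sumOver-⊥ {suc n} a = sumOver-⊥ (a ∘ suc)

sumOver-Empty : (a : Fin n → ℕ) {S : Subset n} → Empty S → sumOver a S ≡ 0
sumOver-Empty a empty rewrite Empty-unique empty = sumOver-⊥ a

sumOver-restrict : (a : Fin (suc n) → ℕ) (S : Subset (suc n)) →
  sumOver a S ≡ sumOver (a ∘ inject₁) (restrict S) + (if isInside (lookup S (fromℕ n)) then a (fromℕ n) else 0)
sumOver-restrict a S = trans (sum-tabulate-inject₁ (λ x → if isInside (lookup S x) then a x else 0)) (cong₂ _+_ (cong sum (tabulate-cong λ i →
  cong (λ b → if isInside b then a (inject₁ i) else 0) (sym (lookup∘tabulate (lookup S ∘ inject₁) i)))) refl)

decode-inject₁ : (i : Fin n) → decode (inject₁ i) ≡ just i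
decode-inject₁ {suc n} zero = refl
decode-inject₁ {suc n} (suc i) rewrite decode-inject₁ i = refl

decode-fromℕ : ∀ n → decode (fromℕ n) ≡ nothing
decode-fromℕ zero = refl
decode-fromℕ (suc n) rewrite decode-fromℕ n = refl

extendOne-inject₁ : (c : Fin n → ℕ) (i : Fin n) → extendOne c (inject₁ i) ≡ c i
extendOne-inject₁ c i with decode (inject₁ i) | decode-inject₁ i
... | .(just i) | refl = refl

extendOne-fromℕ : (c : Fin n → ℕ) → extendOne c (fromℕ n) ≡ 1
extendOne-fromℕ {n} c with decode (fromℕ n) | decode-fromℕ n
... | .nothing | refl = refl

sumAll-extendOne : (c : Fin n → ℕ) → sumAll (extendOne c) ≡ sumAll c + 1
sumAll-extendOne c = trans (sum-tabulate-inject₁ (extendOne c))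
  (cong₂ _+_ (cong sum (tabulate-cong (extendOne-inject₁ c))) (extendOne-fromℕ c))

sumOver-extendOne : (c : Fin n → ℕ) (S : Subset (suc n)) →
  sumOver (extendOne c) S ≡ sumOver c (restrict S) + indicator (lookup S (fromℕ n))
sumOver-extendOne {n} c S = trans (sumOver-restrict (extendOne c) S)
  (cong₂ _+_ (sumOver-cong (extendOne-inject₁ c) (restrict S))
             (cong (if isInside (lookup S (fromℕ n)) then_else 0) (extendOne-fromℕ c)))

adj-triangle-inject₁ : (G : Graph n) (u v i j : Fin n) →
  adj (triangle G u v) (inject₁ i) (inject₁ j) ≡ adj G i j
adj-triangle-inject₁ G u v i j = cong₂ (triAdjM G u v) (decode-inject₁ i) (decode-inject₁ j)

adj-triangle-fromℕ : (G : Graph n) (u v : Fin n) → adj (triangle G u v) (fromℕ n) (inject₁ u) ≡ true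
adj-triangle-fromℕ {n} G u v rewrite decode-fromℕ n | decode-inject₁ u | dec-true (u ≟ u) refl = refl

∈⇒isInside : ∀ {S : Subset n} {j} → j ∈ S → isInside (lookup S j) ≡ true
∈⇒isInside j∈S rewrite []=⇒lookup j∈S = refl

isInside⇒∈ : ∀ {S : Subset n} {j} → isInside (lookup S j) ≡ true → j ∈ S
isInside⇒∈ {S = S} {j} h with lookup S j in eq
isInside⇒∈ {S = S} {j} h  | true = lookup⇒[]= j S eq
isInside⇒∈ {S = S} {j} () | false

anyFin⁺ : (f : Fin n → Bool) (k : Fin n) → f k ≡ true → anyFin f ≡ true
anyFin⁺ f zero fk rewrite fk = refl
anyFin⁺ f (suc k) fk rewrite anyFin⁺ (f ∘ suc) k fk = ∨-zeroʳ (f zero)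

anyFin⁻ : (f : Fin n → Bool) → anyFin f ≡ true → ∃ λ k → f k ≡ true
anyFin⁻ {suc n} f h with f zero in f0
... | true = zero , f0
... | false with anyFin⁻ (f ∘ suc) h
...   | k , fk = suc k , fk

lookup-closedNbhd : (G : Graph n) (S : Subset n) (j : Fin n) →
  isInside (lookup (closedNbhd G S) j) ≡ isInside (lookup S j) ∨ anyFin (λ k → isInside (lookup S k) ∧ adj G k j)
lookup-closedNbhd G S j rewrite lookup∘tabulate
  (λ j → if isInside (lookup S j) ∨ anyFin (λ k → isInside (lookup S k) ∧ adj G k j) then inside else outside) j
  with isInside (lookup S j) ∨ anyFin (λ k → isInside (lookup S k) ∧ adj G k j)
... | true = refl
... | false = refl

⊆-closedNbhd : (G : Graph n) (S : Subset n) → S ⊆ closedNbhd G S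
⊆-closedNbhd G S {j} j∈S =
  isInside⇒∈ (trans (lookup-closedNbhd G S j) (cong₂ _∨_ (∈⇒isInside j∈S) refl))

neighbour∈closedNbhd : (G : Graph n) (S : Subset n) {k j : Fin n} →
  k ∈ S → adj G k j ≡ true → j ∈ closedNbhd G S
neighbour∈closedNbhd G S {k} {j} k∈S kj = isInside⇒∈ (begin
  isInside (lookup (closedNbhd G S) j)                                         ≡⟨ lookup-closedNbhd G S j ⟩
  isInside (lookup S j) ∨ anyFin (λ k → isInside (lookup S k) ∧ adj G k j)    ≡⟨ cong (_ ∨_) (anyFin⁺ _ k kj′) ⟩
  isInside (lookup S j) ∨ true                                                 ≡⟨ ∨-zeroʳ _ ⟩
  true                                                                         ∎)
  where
  open ≡-Reasoning
  kj′ : isInside (lookup S k) ∧ adj G k j ≡ true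
  kj′ = cong₂ _∧_ (∈⇒isInside k∈S) kj

∈-closedNbhd⁻ : (G : Graph n) (S : Subset n) {j : Fin n} →
  j ∈ closedNbhd G S → j ∈ S ⊎ ∃ λ k → k ∈ S × adj G k j ≡ true
∈-closedNbhd⁻ G S {j} j∈ with isInside (lookup S j) in jS | trans (sym (lookup-closedNbhd G S j)) (∈⇒isInside j∈)
... | true  | _ = inj₁ (isInside⇒∈ jS)
... | false | h with anyFin⁻ _ h
...   | k , kj with isInside (lookup S k) in kS | adj G k j in kj′
...     | true | true = inj₂ (k , isInside⇒∈ kS , kj′)

closedNbhd-restrict : (G : Graph n) (H : Graph (suc n)) → (∀ i j → adj H (inject₁ i) (inject₁ j) ≡ adj G i j) →
  (S : Subset (suc n)) → closedNbhd G (restrict S) ⊆ restrict (closedNbhd H S)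
closedNbhd-restrict G H induced S j∈ with ∈-closedNbhd⁻ G (restrict S) j∈
... | inj₁ j∈T = ∈-restrict⁺ (⊆-closedNbhd H S (∈-restrict⁻ j∈T))
... | inj₂ (k , k∈T , kj) = ∈-restrict⁺ (neighbour∈closedNbhd H S (∈-restrict⁻ k∈T) (trans (induced k _) kj))

extendOne-injective : {c c′ : Fin n → ℕ} → (∀ x → extendOne c x ≡ extendOne c′ x) → ∀ i → c i ≡ c′ i
extendOne-injective {c = c} {c′} same i =
  trans (sym (extendOne-inject₁ c i)) (trans (same (inject₁ i)) (extendOne-inject₁ c′ i))

module _ {N : ℕ} (G : Graph N) (u v : Fin N) {c : Fin N → ℕ} (draconian : Draconian G c) where

  private
    G△ : Graph (suc N)
    G△ = triangle G u v

  sumOver-restrict<∣restrict-closedNbhd∣ : (S : Subset (suc N)) → Nonempty S →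
    sumOver c (restrict S) < ∣ restrict (closedNbhd G△ S) ∣
  sumOver-restrict<∣restrict-closedNbhd∣ S ne with nonempty? (restrict S)
  ... | yes neT = <-≤-trans (proj₂ draconian (restrict S) neT)
                            (p⊆q⇒∣p∣≤∣q∣ (closedNbhd-restrict G G△ (adj-triangle-inject₁ G u v) S))
  ... | no emptyT = subst (_< _) (sym (sumOver-Empty c emptyT)) (∈⇒0<∣∣ u∈)
    where
    u∈ : u ∈ restrict (closedNbhd G△ S)
    u∈ = ∈-restrict⁺ (neighbour∈closedNbhd G△ S (Empty-restrict⇒fromℕ∈ ne emptyT) (adj-triangle-fromℕ G u v))

  sumOver-extendOne<∣closedNbhd∣ : (S : Subset (suc N)) → Nonempty S →
    sumOver (extendOne c) S < ∣ closedNbhd G△ S ∣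
  sumOver-extendOne<∣closedNbhd∣ S ne = begin-strict
    sumOver (extendOne c) S                                  ≡⟨ sumOver-extendOne c S ⟩
    sumOver c (restrict S) + indicator (lookup S (fromℕ N))  <⟨ +-mono-<-≤ (sumOver-restrict<∣restrict-closedNbhd∣ S ne)
                                                                             (indicator-mono (⊆-closedNbhd G△ S)) ⟩
    ∣ restrict A ∣ + indicator (lookup A (fromℕ N))           ≡⟨ sym (∣∣-restrict A) ⟩
    ∣ A ∣                                                    ∎
    where
    open ≤-Reasoning
    A : Subset (suc N)
    A = closedNbhd G△ S

  draconian-extendOne : Draconian G△ (extendOne c)
  draconian-extendOne = sumAll-eq , sumOver-extendOne<∣closedNbhd∣
    where
    open ≡-Reasoning
    sumAll-eq : sumAll (extendOne c) + 1 ≡ suc N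
    sumAll-eq = begin
      sumAll (extendOne c) + 1  ≡⟨ cong (_+ 1) (sumAll-extendOne c) ⟩
      sumAll c + 1 + 1          ≡⟨ cong (_+ 1) (proj₁ draconian) ⟩
      N + 1                     ≡⟨ +-comm N 1 ⟩
      suc N                     ∎

lemma3p14 : ∀ {N : ℕ} (G : Graph N) → Connected G → (u v : Fin N) → adj G u v ≡ true →
    (∀ (c : Fin N → ℕ) → Draconian G c → Draconian (triangle G u v) (extendOne c)) ×
    (∀ (c c′ : Fin N → ℕ) → Draconian G c → Draconian G c′ →
      (∀ i → extendOne c i ≡ extendOne c′ i) → ∀ i → c i ≡ c′ i)
lemma3p14 G _ u v _ =
  (λ c → draconian-extendOne G u v) ,
  (λ c c′ _ _ → extendOne-injective)
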